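{- For every graph $G$ the following are equivalent: (i) every induced subgraph $H$ of $G$ satisfies $\tau_c(H) \leq \frac{4}{3}\,\tau(H)$; (ii) $G$ contains neither $P_5$ nor $C_4$ as an induced subgraph.
   Context: All graphs are finite and simple. A vertex cover of $G$ is a set $C \subseteq V(G)$ meeting every edge; $\tau(G)$ is the minimum size of a vertex cover. A connected vertex cover of $G$ is a vertex cover $C$ such that $G[C]$ is connected (if $G$ is disconnected, $G[C]$ must have the same number of connected components as $G$); $\tau_c(G)$ is its minimum size. $P_k$ denotes the path on $k$ vertices and $C_k$ the cycle on $k$ vertices. -}

module Defs where

open import Data.Nat using (ℕ; zero; suc; _+_; _*_; _≤_; _≡ᵇ_; _%_)
open import Data.Bool using (Bool; true; false; _∨_)
open import Data.Bool.Properties using (∨-comm)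
open import Data.Fin using (Fin; toℕ)
import Data.Fin as F
open import Data.Fin.Subset using (Subset; _∈_; _⊆_; ∣_∣)
open import Data.Product using (Σ; _×_; _,_)
open import Function.Definitions using (Injective)
open import Relation.Binary.PropositionalEquality using (_≡_; refl)

record Graph : Set where
  field
    n      : ℕ
    adj    : Fin n → Fin n → Bool
    sym    : ∀ u v → adj u v ≡ adj v u
    irrefl : ∀ u → adj u u ≡ false
open Graph public

private
  suc≢ᵇ : ∀ m → (suc m ≡ᵇ m) ≡ false
  suc≢ᵇ zero    = refl
  suc≢ᵇ (suc m) = suc≢ᵇ m

P : ℕ → Graph
P k = record
  { n = k
  ; adj = λ i j → (suc (toℕ i) ≡ᵇ toℕ j) ∨ (suc (toℕ j) ≡ᵇ toℕ i)
  ; sym = λ i j → ∨-comm (suc (toℕ i) ≡ᵇ toℕ j) (suc (toℕ j) ≡ᵇ toℕ i)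
  ; irrefl = λ i → irr (toℕ i)
  }
  where
  irr : ∀ m → ((suc m ≡ᵇ m) ∨ (suc m ≡ᵇ m)) ≡ false
  irr m rewrite suc≢ᵇ m = refl

C4 : Graph
C4 = record
  { n = 4
  ; adj = a
  ; sym = λ i j → ∨-comm ((suc (toℕ i) % 4) ≡ᵇ toℕ j) ((suc (toℕ j) % 4) ≡ᵇ toℕ i)
  ; irrefl = irr
  }
  where
  a : Fin 4 → Fin 4 → Bool
  a i j = ((suc (toℕ i) % 4) ≡ᵇ toℕ j) ∨ ((suc (toℕ j) % 4) ≡ᵇ toℕ i)
  irr : ∀ u → a u u ≡ false
  irr F.zero = refl
  irr (F.suc F.zero) = refl
  irr (F.suc (F.suc F.zero)) = refl
  irr (F.suc (F.suc (F.suc F.zero))) = refl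

InducedSub : Graph → Graph → Set
InducedSub F G =
  Σ (Fin (n F) → Fin (n G)) λ f →
    Injective _≡_ _≡_ f × (∀ i j → adj G (f i) (f j) ≡ adj F i j)

module _ (G : Graph) where

  -- Throughout, S : Subset (n G) denotes the vertex set of the induced
  -- subgraph H = G[S].

  IsVC : Subset (n G) → Subset (n G) → Set
  IsVC S C = C ⊆ S × (∀ u v → u ∈ S → v ∈ S → adj G u v ≡ true → u ∈ C Data.Sum.⊎ v ∈ C)
    where import Data.Sum

  data Walk (T : Subset (n G)) : Fin (n G) → Fin (n G) → Set where
    here : ∀ {u} → u ∈ T → Walk T u u
    step : ∀ {u w v} → u ∈ T → adj G u w ≡ true → Walk T w v → Walk T u v

  -- C is a connected vertex cover of G[S]: a vertex cover of G[S] such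
  -- that any two vertices of C lying in the same component of G[S]
  -- are connected in G[C] (i.e. G[C] meets every nontrivial component
  -- of G[S] in a connected set).
  IsCVC : Subset (n G) → Subset (n G) → Set
  IsCVC S C = IsVC S C × (∀ u v → u ∈ C → v ∈ C → Walk S u v → Walk C u v)

  -- Minimum (connected) vertex covers; τ(G[S]) = ∣ C ∣ for a minimum
  -- vertex cover C, τ_c(G[S]) = ∣ D ∣ for a minimum connected one.
  IsMinVC : Subset (n G) → Subset (n G) → Set
  IsMinVC S C = IsVC S C × (∀ C′ → IsVC S C′ → ∣ C ∣ ≤ ∣ C′ ∣)

  IsMinCVC : Subset (n G) → Subset (n G) → Set
  IsMinCVC S D = IsCVC S D × (∀ D′ → IsCVC S D′ → ∣ D ∣ ≤ ∣ D′ ∣)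

  -- Every induced subgraph H = G[S] satisfies τ_c(H) ≤ (4/3) τ(H),
  -- written as 3 τ_c(H) ≤ 4 τ(H).
  PriceBound : Set
  PriceBound = ∀ (S C D : Subset (n G)) → IsMinVC S C → IsMinCVC S D →
               3 * ∣ D ∣ ≤ 4 * ∣ C ∣

-- (i) ⇒ (ii): P5 and C4 have τ = 2 and τ_c = 3, and 3 · 3 > 4 · 2; an induced copy
-- of either in G is an induced subgraph of G with the same two parameters.
-- (ii) ⇒ (i): component by component, turn a vertex cover C of a connected induced
-- subgraph K into a connected cover D with 3|D| ≤ 4|C|. If G[C] is disconnected,
-- let R x be the part of C linked to a vertex x ∉ C through G[C]. Without induced
-- P5, R x can be enlarged as long as it misses part of C, so some x has R x = C
-- and C ∪ {x} is a connected cover, small enough once |C| ≥ 3. If C = {u, v},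
-- excluding P5 makes the neighbourhood of one of u, v, say u, lie inside that of
-- the other, and excluding C4 then reduces it to {x}, so {x, v} is a connected cover.

module Submission where

open import Defs renaming (sym to adj-sym)
open import Data.Bool using (true; false)
import Data.Bool.Properties as Boolₚ
open import Data.Empty using (⊥; ⊥-elim)
open import Data.Fin using (Fin) renaming (zero to fz; suc to fs)
import Data.Fin as Fin
open import Data.Fin.Properties using (any?; all?)
open import Data.Fin.Subset
  using (Subset; _∈_; _∉_; _⊆_; _⊂_; _⊃_; ∣_∣; ⁅_⁆; _∪_; _∩_; _─_; outside; inside)
  renaming (⊥ to ∅; ⊤ to full)
open import Data.Fin.Subset.Properties
open import Data.Fin.Subset.Induction using (Acc; acc; ⊂-wellFounded; ⊃-wellFounded)
open import Data.Nat using (ℕ; suc; _+_; _*_; _≤_; _<_; _≤?_; z≤n; s≤s)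
open import Data.Nat.Properties
  using (≤-refl; ≤-reflexive; ≤-trans; n≤1+n; 1+n≰n; +-comm; +-suc; *-suc; *-distribˡ-+;
         +-mono-≤; +-monoˡ-≤; +-monoʳ-≤; *-monoˡ-≤; *-monoʳ-≤; module ≤-Reasoning)
open import Data.Product using (∃; ∃₂; _×_; _,_; proj₁; proj₂)
open import Data.Sum using (_⊎_; inj₁; inj₂; [_,_]′)
import Data.Sum as Sum
open import Data.Vec using ([]; _∷_; lookup; tabulate)
import Data.Vec.Base as Vec
open import Data.Vec.Relation.Unary.All using ([]; _∷_)
open import Data.Vec.Relation.Unary.AllPairs using ([]; _∷_)
open import Data.Vec.Relation.Unary.Unique.Propositional using (Unique)
open import Data.Vec.Relation.Unary.Unique.Propositional.Properties using (lookup-injective)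
open import Data.Vec.Properties using (lookup∘tabulate; []=⇒lookup; lookup⇒[]=)
open import Function using (_∘_)
open import Function.Bundles using (_⇔_; mk⇔)
open import Level using (Level)
open import Relation.Binary.PropositionalEquality
  using (_≡_; _≢_; refl; sym; trans; cong; cong₂; subst; ≢-sym)
open import Relation.Nullary using (¬_; Dec; yes; no; does)
open import Relation.Nullary.Decidable
  using (toWitness; dec-true; decidable-stable; map′; _×-dec_; _⊎-dec_; _→-dec_; ¬?)
open import Relation.Unary using (Pred; Decidable)

private
  variable
    ℓ : Level
    m : ℕ

module _ {P : Pred (Fin m) ℓ} (P? : Decidable P) where

  select : Subset m
  select = tabulate (does ∘ P?)

  ∈-select⁺ : ∀ {i} → P i → i ∈ select
  ∈-select⁺ {i} p = lookup⇒[]= i select (trans (lookup∘tabulate _ i) (dec-true (P? i) p))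

  ∈-select⁻ : ∀ {i} → i ∈ select → P i
  ∈-select⁻ {i} i∈ = yes-witness (P? i) (trans (sym (lookup∘tabulate _ i)) ([]=⇒lookup i∈))
    where
    yes-witness : ∀ {A : Set ℓ} (a? : Dec A) → does a? ≡ true → A
    yes-witness (yes a) _ = a

∣p∪q∣≤∣p∣+∣q∣ : ∀ (p q : Subset m) → ∣ p ∪ q ∣ ≤ ∣ p ∣ + ∣ q ∣
∣p∪q∣≤∣p∣+∣q∣ []             []             = z≤n
∣p∪q∣≤∣p∣+∣q∣ (inside  ∷ p) (inside  ∷ q) = s≤s (≤-trans (∣p∪q∣≤∣p∣+∣q∣ p q) (+-monoʳ-≤ ∣ p ∣ (n≤1+n _)))
∣p∪q∣≤∣p∣+∣q∣ (inside  ∷ p) (outside ∷ q) = s≤s (∣p∪q∣≤∣p∣+∣q∣ p q)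
∣p∪q∣≤∣p∣+∣q∣ (outside ∷ p) (inside  ∷ q) =
  ≤-trans (s≤s (∣p∪q∣≤∣p∣+∣q∣ p q)) (≤-reflexive (sym (+-suc ∣ p ∣ ∣ q ∣)))
∣p∪q∣≤∣p∣+∣q∣ (outside ∷ p) (outside ∷ q) = ∣p∪q∣≤∣p∣+∣q∣ p q

∣p∪⁅x⁆∣≤1+∣p∣ : ∀ (p : Subset m) x → ∣ p ∪ ⁅ x ⁆ ∣ ≤ suc ∣ p ∣
∣p∪⁅x⁆∣≤1+∣p∣ p x =
  ≤-trans (∣p∪q∣≤∣p∣+∣q∣ p ⁅ x ⁆) (≤-reflexive (trans (cong (∣ p ∣ +_) (∣⁅x⁆∣≡1 x)) (+-comm ∣ p ∣ 1)))

∣⁅x⁆∪⁅y⁆∣≤2 : ∀ (x y : Fin m) → ∣ ⁅ x ⁆ ∪ ⁅ y ⁆ ∣ ≤ 2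
∣⁅x⁆∪⁅y⁆∣≤2 x y = ≤-trans (∣p∪q∣≤∣p∣+∣q∣ ⁅ x ⁆ ⁅ y ⁆) (≤-reflexive (cong₂ _+_ (∣⁅x⁆∣≡1 x) (∣⁅x⁆∣≡1 y)))

∈⁅x⁆∪⁅y⁆⁻ : ∀ {x y z : Fin m} → z ∈ ⁅ x ⁆ ∪ ⁅ y ⁆ → z ≡ x ⊎ z ≡ y
∈⁅x⁆∪⁅y⁆⁻ {x = x} {y} z∈ = Sum.map (x∈⁅y⁆⇒x≡y x) (x∈⁅y⁆⇒x≡y y) (x∈p∪q⁻ ⁅ x ⁆ ⁅ y ⁆ z∈)

∣p∩q∣+∣p─q∣≡∣p∣ : ∀ (p q : Subset m) → ∣ p ∩ q ∣ + ∣ p ─ q ∣ ≡ ∣ p ∣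
∣p∩q∣+∣p─q∣≡∣p∣ []             []             = refl
∣p∩q∣+∣p─q∣≡∣p∣ (inside  ∷ p) (inside  ∷ q) = cong suc (∣p∩q∣+∣p─q∣≡∣p∣ p q)
∣p∩q∣+∣p─q∣≡∣p∣ (inside  ∷ p) (outside ∷ q) = trans (+-suc _ _) (cong suc (∣p∩q∣+∣p─q∣≡∣p∣ p q))
∣p∩q∣+∣p─q∣≡∣p∣ (outside ∷ p) (inside  ∷ q) = ∣p∩q∣+∣p─q∣≡∣p∣ p q
∣p∩q∣+∣p─q∣≡∣p∣ (outside ∷ p) (outside ∷ q) = ∣p∩q∣+∣p─q∣≡∣p∣ p q

x∈p─q⇒x∉q : ∀ {p q : Subset m} {x} → x ∈ p ─ q → x ∉ q
x∈p─q⇒x∉q {p = inside ∷ p} {outside ∷ q} Vec.here ()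
x∈p─q⇒x∉q {p = _ ∷ p} {_ ∷ q} (Vec.there x∈) (Vec.there x∈q) = x∈p─q⇒x∉q x∈ x∈q

x∈p⇒0<∣p∣ : ∀ {p : Subset m} {x} → x ∈ p → 0 < ∣ p ∣
x∈p⇒0<∣p∣ x∈ = ≤-trans (s≤s z≤n) (x∈p⇒∣p-x∣<∣p∣ x∈)

two-members⇒2≤∣p∣ : ∀ {p : Subset m} {x y} → x ∈ p → y ∈ p → x ≢ y → 2 ≤ ∣ p ∣
two-members⇒2≤∣p∣ x∈ y∈ x≢y =
  ≤-trans (s≤s (x∈p⇒0<∣p∣ (x∈p∧x≢y⇒x∈p-y y∈ (x≢y ∘ sym)))) (x∈p⇒∣p-x∣<∣p∣ x∈)

three-members⇒3≤∣p∣ : ∀ {p : Subset m} {x y z} → x ∈ p → y ∈ p → z ∈ p →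
                      x ≢ y → x ≢ z → y ≢ z → 3 ≤ ∣ p ∣
three-members⇒3≤∣p∣ x∈ y∈ z∈ x≢y x≢z y≢z =
  ≤-trans (s≤s (two-members⇒2≤∣p∣ (x∈p∧x≢y⇒x∈p-y y∈ (x≢y ∘ sym)) (x∈p∧x≢y⇒x∈p-y z∈ (x≢z ∘ sym)) y≢z))
          (x∈p⇒∣p-x∣<∣p∣ x∈)

∀-subset? : ∀ {P : Pred (Subset m) ℓ} → Decidable P → Dec (∀ p → P p)
∀-subset? P? = map′ (λ ∄¬P p → decidable-stable (P? p) (∄¬P ∘ (p ,_)))
                    (λ ∀P (p , ¬Pp) → ¬Pp (∀P p))
                    (¬? (anySubset? (¬? ∘ P?)))

image : ∀ {k} → (Fin m → Fin k) → Subset m → Subset k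
image f []            = ∅
image f (inside  ∷ I) = ⁅ f fz ⁆ ∪ image (f ∘ fs) I
image f (outside ∷ I) = image (f ∘ fs) I

∈-image⁺ : ∀ {k} (f : Fin m → Fin k) {I i} → i ∈ I → f i ∈ image f I
∈-image⁺ f {inside  ∷ I} Vec.here       = x∈p∪q⁺ (inj₁ (x∈⁅x⁆ (f fz)))
∈-image⁺ f {inside  ∷ I} (Vec.there i∈) = x∈p∪q⁺ (inj₂ (∈-image⁺ (f ∘ fs) i∈))
∈-image⁺ f {outside ∷ I} (Vec.there i∈) = ∈-image⁺ (f ∘ fs) i∈

∈-image⁻ : ∀ {k} (f : Fin m → Fin k) I {x} → x ∈ image f I → ∃ λ i → i ∈ I × f i ≡ x
∈-image⁻ f []            x∈ = ⊥-elim (∉⊥ x∈)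
∈-image⁻ f (inside  ∷ I) x∈ with x∈p∪q⁻ ⁅ f fz ⁆ _ x∈
... | inj₁ x∈⁅f0⁆ = fz , Vec.here , sym (x∈⁅y⁆⇒x≡y _ x∈⁅f0⁆)
... | inj₂ x∈′ with ∈-image⁻ (f ∘ fs) I x∈′
...   | i , i∈ , fi≡x = fs i , Vec.there i∈ , fi≡x
∈-image⁻ f (outside ∷ I) x∈ with ∈-image⁻ (f ∘ fs) I x∈
... | i , i∈ , fi≡x = fs i , Vec.there i∈ , fi≡x

∣image∣≤∣p∣ : ∀ {k} (f : Fin m → Fin k) I → ∣ image f I ∣ ≤ ∣ I ∣
∣image∣≤∣p∣ {k = k} f [] = ≤-reflexive (∣⊥∣≡0 k)
∣image∣≤∣p∣ f (inside  ∷ I) =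
  ≤-trans (∣p∪q∣≤∣p∣+∣q∣ ⁅ f fz ⁆ _)
          (≤-trans (≤-reflexive (cong (_+ ∣ image (f ∘ fs) I ∣) (∣⁅x⁆∣≡1 (f fz))))
                   (s≤s (∣image∣≤∣p∣ (f ∘ fs) I)))
∣image∣≤∣p∣ f (outside ∷ I) = ∣image∣≤∣p∣ (f ∘ fs) I

module Closure (expand : Subset m → Subset m) (inflationary : ∀ X → X ⊆ expand X) where

  closure′ : ∀ X → Acc _⊃_ X → Subset m
  closure′ X (acc rec) with X ⊂? expand X
  ... | yes X⊂ = closure′ (expand X) (rec X⊂)
  ... | no  _  = X

  closure : Subset m → Subset m
  closure X = closure′ X (⊃-wellFounded X)

  ⊆-closure′ : ∀ X (a : Acc _⊃_ X) → X ⊆ closure′ X a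
  ⊆-closure′ X (acc rec) with X ⊂? expand X
  ... | yes X⊂ = ⊆-closure′ (expand X) (rec X⊂) ∘ inflationary X
  ... | no  _  = λ x∈ → x∈

  closure′-closed : ∀ X (a : Acc _⊃_ X) → expand (closure′ X a) ⊆ closure′ X a
  closure′-closed X (acc rec) with X ⊂? expand X
  ... | yes X⊂ = closure′-closed (expand X) (rec X⊂)
  ... | no  X⊄ = fixed
    where
    fixed : expand X ⊆ X
    fixed {x} x∈ = decidable-stable (x ∈? X) (λ x∉ → X⊄ (inflationary X , x , x∈ , x∉))

  closure′-induction : (Q : Pred (Fin m) ℓ) →
    (∀ Y → (∀ {x} → x ∈ Y → Q x) → ∀ {x} → x ∈ expand Y → Q x) →
    ∀ X (a : Acc _⊃_ X) → (∀ {x} → x ∈ X → Q x) → ∀ {x} → x ∈ closure′ X a → Q x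
  closure′-induction Q preserved X (acc rec) QX with X ⊂? expand X
  ... | yes X⊂ = closure′-induction Q preserved (expand X) (rec X⊂) (preserved X QX)
  ... | no  _  = QX

  ⊆-closure : ∀ X → X ⊆ closure X
  ⊆-closure X = ⊆-closure′ X (⊃-wellFounded X)

  closure-closed : ∀ X → expand (closure X) ⊆ closure X
  closure-closed X = closure′-closed X (⊃-wellFounded X)

  closure-induction : (Q : Pred (Fin m) ℓ) →
    (∀ Y → (∀ {x} → x ∈ Y → Q x) → ∀ {x} → x ∈ expand Y → Q x) →
    ∀ X → (∀ {x} → x ∈ X → Q x) → ∀ {x} → x ∈ closure X → Q x
  closure-induction Q preserved X = closure′-induction Q preserved X (⊃-wellFounded X)

3*[1+c]≤4*c : ∀ c → 3 ≤ c → 3 * suc c ≤ 4 * c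
3*[1+c]≤4*c c 3≤c = begin
  3 * suc c  ≡⟨ *-suc 3 c ⟩
  3 + 3 * c  ≤⟨ +-monoˡ-≤ (3 * c) 3≤c ⟩
  4 * c      ∎
  where open ≤-Reasoning

3*d≤4*c : ∀ {c d} → d ≤ 2 → 2 ≤ c → 3 * d ≤ 4 * c
3*d≤4*c {c} {d} d≤2 2≤c = begin
  3 * d  ≤⟨ *-monoʳ-≤ 3 d≤2 ⟩
  6      ≤⟨ ≤-trans (n≤1+n 6) (n≤1+n 7) ⟩
  8      ≤⟨ *-monoʳ-≤ 4 2≤c ⟩
  4 * c  ∎
  where open ≤-Reasoning

module GraphTheory (G : Graph) where

  V : Set
  V = Fin (n G)

  infix 4 _~_ _≁_
  _~_ _≁_ : V → V → Set
  u ~ v = adj G u v ≡ true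
  u ≁ v = adj G u v ≡ false

  adj-flip : ∀ {u v b} → adj G u v ≡ b → adj G v u ≡ b
  adj-flip {u} {v} uv = trans (adj-sym G v u) uv

  adj? : ∀ u v → Dec (u ~ v)
  adj? u v = adj G u v Boolₚ.≟ true

  ¬~⇒≁ : ∀ {u v} → ¬ u ~ v → u ≁ v
  ¬~⇒≁ = Boolₚ.¬-not

  ~⇒≢ : ∀ {u v} → u ~ v → u ≢ v
  ~⇒≢ {u} u~v refl with () ← trans (sym u~v) (irrefl G u)

  distinguished : ∀ {x y z} → x ~ z → y ≁ z → x ≢ y
  distinguished x~z y≁z refl with () ← trans (sym x~z) y≁z

  walk-head : ∀ {T u v} → Walk G T u v → u ∈ T
  walk-head (here u∈) = u∈
  walk-head (step u∈ _ _) = u∈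

  walk-last : ∀ {T u v} → Walk G T u v → v ∈ T
  walk-last (here v∈) = v∈
  walk-last (step _ _ p) = walk-last p

  walk-mono : ∀ {T T′ u v} → T ⊆ T′ → Walk G T u v → Walk G T′ u v
  walk-mono T⊆ (here u∈) = here (T⊆ u∈)
  walk-mono T⊆ (step u∈ e p) = step (T⊆ u∈) e (walk-mono T⊆ p)

  walk-trans : ∀ {T u v w} → Walk G T u v → Walk G T v w → Walk G T u w
  walk-trans (here _) q = q
  walk-trans (step u∈ e p) q = step u∈ e (walk-trans p q)

  walk-snoc : ∀ {T u v w} → Walk G T u v → v ~ w → w ∈ T → Walk G T u w
  walk-snoc p e w∈ = walk-trans p (step (walk-last p) e (here w∈))

  walk-sym : ∀ {T u v} → Walk G T u v → Walk G T v u
  walk-sym (here u∈) = here u∈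
  walk-sym (step u∈ e p) = walk-snoc (walk-sym p) (adj-flip e) u∈

  Closed : Subset (n G) → Subset (n G) → Set
  Closed X T = ∀ {v w} → v ∈ X → w ∈ T → v ~ w → w ∈ X

  walk-closed : ∀ {X T u v} → Closed X T → u ∈ X → Walk G T u v → Walk G X u v
  walk-closed X-closed u∈ (here _) = here u∈
  walk-closed X-closed u∈ (step _ e p) =
    step u∈ e (walk-closed X-closed (X-closed u∈ (walk-head p) e) p)

  walk-crossing : ∀ {T} {Q : Pred V ℓ} → Decidable Q → ∀ {u v} → Walk G T u v → Q u → ¬ Q v →
                  ∃₂ λ a b → a ∈ T × b ∈ T × Q a × ¬ Q b × a ~ b
  walk-crossing Q? (here _) Qu ¬Qv = ⊥-elim (¬Qv Qu)
  walk-crossing Q? (step {u = u} {w = w} u∈ e p) Qu ¬Qv with Q? w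
  ... | yes Qw = walk-crossing Q? p Qw ¬Qv
  ... | no ¬Qw = u , w , u∈ , walk-head p , Qu , ¬Qw , e

  attached? : ∀ T X → Decidable (λ w → w ∈ T × ∃ λ v → v ∈ X × v ~ w)
  attached? T X w = (w ∈? T) ×-dec any? (λ v → (v ∈? X) ×-dec adj? v w)

  neighbourhood : Subset (n G) → Subset (n G) → Subset (n G)
  neighbourhood T X = X ∪ select (attached? T X)

  reach : Subset (n G) → V → Subset (n G)
  reach T u = closure (⁅ u ⁆ ∩ T)
    where open Closure (neighbourhood T) (λ X → p⊆p∪q _)

  module _ {T : Subset (n G)} {u : V} where
    open Closure (neighbourhood T) (λ X → p⊆p∪q _)

    reach-sound : ∀ {v} → v ∈ reach T u → Walk G T u v
    reach-sound = closure-induction (Walk G T u) extend (⁅ u ⁆ ∩ T) start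
      where
      start : ∀ {v} → v ∈ ⁅ u ⁆ ∩ T → Walk G T u v
      start v∈ with x∈p∩q⁻ ⁅ u ⁆ T v∈
      ... | v∈⁅u⁆ , v∈T rewrite x∈⁅y⁆⇒x≡y u v∈⁅u⁆ = here v∈T
      extend : ∀ X → (∀ {v} → v ∈ X → Walk G T u v) → ∀ {w} → w ∈ neighbourhood T X → Walk G T u w
      extend X walks w∈ with x∈p∪q⁻ X _ w∈
      ... | inj₁ w∈X = walks w∈X
      ... | inj₂ w∈N with ∈-select⁻ (attached? T X) w∈N
      ...   | w∈T , v , v∈X , v~w = walk-snoc (walks v∈X) v~w w∈T

    reach-complete : ∀ {v} → Walk G T u v → v ∈ reach T u
    reach-complete p = walk-last (walk-closed reach-closed (⊆-closure _ u∈) p)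
      where
      u∈ : u ∈ ⁅ u ⁆ ∩ T
      u∈ = x∈p∩q⁺ (x∈⁅x⁆ u , walk-head p)
      reach-closed : Closed (reach T u) T
      reach-closed v∈ w∈T v~w =
        closure-closed (⁅ u ⁆ ∩ T) (x∈p∪q⁺ (inj₂ (∈-select⁺ (attached? T (reach T u)) (w∈T , _ , v∈ , v~w))))

  walk? : ∀ T u v → Dec (Walk G T u v)
  walk? T u v = map′ reach-sound reach-complete (v ∈? reach T u)

  induced-P5 : ∀ {p₀ p₁ p₂ p₃ p₄} →
               p₀ ~ p₁ → p₁ ~ p₂ → p₂ ~ p₃ → p₃ ~ p₄ →
               p₀ ≁ p₂ → p₀ ≁ p₃ → p₀ ≁ p₄ → p₁ ≁ p₃ → p₁ ≁ p₄ → p₂ ≁ p₄ →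
               InducedSub (P 5) G
  induced-P5 {p₀} {p₁} {p₂} {p₃} {p₄} e₀₁ e₁₂ e₂₃ e₃₄ n₀₂ n₀₃ n₀₄ n₁₃ n₁₄ n₂₄ =
    lookup ps , lookup-injective distinct _ _ , agrees
    where
    ps = p₀ ∷ p₁ ∷ p₂ ∷ p₃ ∷ p₄ ∷ []
    distinct : Unique ps
    distinct =
      (~⇒≢ e₀₁ ∷ ≢-sym (distinguished e₂₃ n₀₃) ∷ ≢-sym (distinguished (adj-flip e₂₃) n₀₂)
               ∷ ≢-sym (distinguished (adj-flip e₃₄) n₀₃) ∷ []) ∷
      (~⇒≢ e₁₂ ∷ ≢-sym (distinguished e₃₄ n₁₄) ∷ ≢-sym (distinguished (adj-flip e₃₄) n₁₃) ∷ []) ∷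
      (~⇒≢ e₂₃ ∷ distinguished (adj-flip e₁₂) (adj-flip n₁₄) ∷ []) ∷
      (~⇒≢ e₃₄ ∷ []) ∷ [] ∷ []
    agrees : ∀ i j → adj G (lookup ps i) (lookup ps j) ≡ adj (P 5) i j
    agrees fz                     fz                     = irrefl G _
    agrees fz                     (fs fz)                = e₀₁
    agrees fz                     (fs (fs fz))           = n₀₂
    agrees fz                     (fs (fs (fs fz)))      = n₀₃
    agrees fz                     (fs (fs (fs (fs fz)))) = n₀₄
    agrees (fs fz)                fz                     = adj-flip e₀₁
    agrees (fs fz)                (fs fz)                = irrefl G _
    agrees (fs fz)                (fs (fs fz))           = e₁₂
    agrees (fs fz)                (fs (fs (fs fz)))      = n₁₃
    agrees (fs fz)                (fs (fs (fs (fs fz)))) = n₁₄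
    agrees (fs (fs fz))           fz                     = adj-flip n₀₂
    agrees (fs (fs fz))           (fs fz)                = adj-flip e₁₂
    agrees (fs (fs fz))           (fs (fs fz))           = irrefl G _
    agrees (fs (fs fz))           (fs (fs (fs fz)))      = e₂₃
    agrees (fs (fs fz))           (fs (fs (fs (fs fz)))) = n₂₄
    agrees (fs (fs (fs fz)))      fz                     = adj-flip n₀₃
    agrees (fs (fs (fs fz)))      (fs fz)                = adj-flip n₁₃
    agrees (fs (fs (fs fz)))      (fs (fs fz))           = adj-flip e₂₃
    agrees (fs (fs (fs fz)))      (fs (fs (fs fz)))      = irrefl G _
    agrees (fs (fs (fs fz)))      (fs (fs (fs (fs fz)))) = e₃₄
    agrees (fs (fs (fs (fs fz)))) fz                     = adj-flip n₀₄
    agrees (fs (fs (fs (fs fz)))) (fs fz)                = adj-flip n₁₄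
    agrees (fs (fs (fs (fs fz)))) (fs (fs fz))           = adj-flip n₂₄
    agrees (fs (fs (fs (fs fz)))) (fs (fs (fs fz)))      = adj-flip e₃₄
    agrees (fs (fs (fs (fs fz)))) (fs (fs (fs (fs fz)))) = irrefl G _

  induced-C4 : ∀ {p₀ p₁ p₂ p₃} →
               p₀ ~ p₁ → p₁ ~ p₂ → p₂ ~ p₃ → p₃ ~ p₀ → p₀ ≁ p₂ → p₁ ≁ p₃ → p₀ ≢ p₂ → p₁ ≢ p₃ →
               InducedSub C4 G
  induced-C4 {p₀} {p₁} {p₂} {p₃} e₀₁ e₁₂ e₂₃ e₃₀ n₀₂ n₁₃ p₀≢p₂ p₁≢p₃ =
    lookup ps , lookup-injective distinct _ _ , agrees
    where
    ps = p₀ ∷ p₁ ∷ p₂ ∷ p₃ ∷ []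
    distinct : Unique ps
    distinct = (~⇒≢ e₀₁ ∷ p₀≢p₂ ∷ ≢-sym (~⇒≢ e₃₀) ∷ []) ∷ (~⇒≢ e₁₂ ∷ p₁≢p₃ ∷ []) ∷ (~⇒≢ e₂₃ ∷ []) ∷ [] ∷ []
    agrees : ∀ i j → adj G (lookup ps i) (lookup ps j) ≡ adj C4 i j
    agrees fz                fz                = irrefl G _
    agrees fz                (fs fz)           = e₀₁
    agrees fz                (fs (fs fz))      = n₀₂
    agrees fz                (fs (fs (fs fz))) = adj-flip e₃₀
    agrees (fs fz)           fz                = adj-flip e₀₁
    agrees (fs fz)           (fs fz)           = irrefl G _
    agrees (fs fz)           (fs (fs fz))      = e₁₂
    agrees (fs fz)           (fs (fs (fs fz))) = n₁₃
    agrees (fs (fs fz))      fz                = adj-flip n₀₂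
    agrees (fs (fs fz))      (fs fz)           = adj-flip e₁₂
    agrees (fs (fs fz))      (fs (fs fz))      = irrefl G _
    agrees (fs (fs fz))      (fs (fs (fs fz))) = e₂₃
    agrees (fs (fs (fs fz))) fz                = e₃₀
    agrees (fs (fs (fs fz))) (fs fz)           = adj-flip n₁₃
    agrees (fs (fs (fs fz))) (fs (fs fz))      = adj-flip e₂₃
    agrees (fs (fs (fs fz))) (fs (fs (fs fz))) = irrefl G _

  isVC? : ∀ S C → Dec (IsVC G S C)
  isVC? S C = (C ⊆? S) ×-dec all? λ u → all? λ v →
    (u ∈? S) →-dec (v ∈? S) →-dec adj? u v →-dec ((u ∈? C) ⊎-dec (v ∈? C))

  isCVC? : ∀ S C → Dec (IsCVC G S C)
  isCVC? S C = isVC? S C ×-dec all? λ u → all? λ v →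
    (u ∈? C) →-dec (v ∈? C) →-dec walk? S u v →-dec walk? C u v

  IsVC-∩ : ∀ {S T C} → T ⊆ S → IsVC G S C → IsVC G T (C ∩ T)
  IsVC-∩ {S} {T} {C} T⊆S (_ , covers) = p∩q⊆q C T , restricted
    where
    restricted : ∀ u v → u ∈ T → v ∈ T → u ~ v → u ∈ C ∩ T ⊎ v ∈ C ∩ T
    restricted u v u∈ v∈ u~v with covers u v (T⊆S u∈) (T⊆S v∈) u~v
    ... | inj₁ u∈C = inj₁ (x∈p∩q⁺ (u∈C , u∈))
    ... | inj₂ v∈C = inj₂ (x∈p∩q⁺ (v∈C , v∈))

  IsVC-─ : ∀ {S T C} → IsVC G S C → IsVC G (S ─ T) (C ─ T)
  IsVC-─ {S} {T} {C} (C⊆S , covers) = C─T⊆S─T , restricted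
    where
    C─T⊆S─T : C ─ T ⊆ S ─ T
    C─T⊆S─T x∈ = x∈p∧x∉q⇒x∈p─q (C⊆S (p─q⊆p C T x∈)) (x∈p─q⇒x∉q x∈)
    restricted : ∀ u v → u ∈ S ─ T → v ∈ S ─ T → u ~ v → u ∈ C ─ T ⊎ v ∈ C ─ T
    restricted u v u∈ v∈ u~v with covers u v (p─q⊆p S T u∈) (p─q⊆p S T v∈) u~v
    ... | inj₁ u∈C = inj₁ (x∈p∧x∉q⇒x∈p─q u∈C (x∈p─q⇒x∉q u∈))
    ... | inj₂ v∈C = inj₂ (x∈p∧x∉q⇒x∈p─q v∈C (x∈p─q⇒x∉q v∈))

  ∅-isCVC : ∀ {S} → (∀ v → v ∉ S) → IsCVC G S ∅
  ∅-isCVC S-empty = ((⊥-elim ∘ ∉⊥) , λ u _ u∈ _ _ → ⊥-elim (S-empty u u∈)) , λ u _ u∈ _ _ → ⊥-elim (∉⊥ u∈)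

  closed-complement : ∀ {S T} → Closed T S → Closed (S ─ T) S
  closed-complement {S} {T} T-closed v∈ w∈S v~w =
    x∈p∧x∉q⇒x∈p─q w∈S (λ w∈T → x∈p─q⇒x∉q v∈ (T-closed w∈T (p─q⊆p S T v∈) (adj-flip v~w)))

  IsCVC-∪ : ∀ {S T D₁ D₂} → T ⊆ S → Closed T S → IsCVC G T D₁ → IsCVC G (S ─ T) D₂ →
            IsCVC G S (D₁ ∪ D₂)
  IsCVC-∪ {S} {T} {D₁} {D₂} T⊆S T-closed ((D₁⊆T , covers₁) , joined₁) ((D₂⊆S─T , covers₂) , joined₂) =
    (D⊆S , covers) , joined
    where
    D⊆S : D₁ ∪ D₂ ⊆ S
    D⊆S x∈ = [ T⊆S ∘ D₁⊆T , p─q⊆p S T ∘ D₂⊆S─T ]′ (x∈p∪q⁻ D₁ D₂ x∈)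
    in-D₁ : ∀ {x} → x ∈ D₁ ∪ D₂ → x ∈ T → x ∈ D₁
    in-D₁ x∈ x∈T = [ (λ x∈D₁ → x∈D₁) , (λ x∈D₂ → ⊥-elim (x∈p─q⇒x∉q (D₂⊆S─T x∈D₂) x∈T)) ]′ (x∈p∪q⁻ D₁ D₂ x∈)
    in-D₂ : ∀ {x} → x ∈ D₁ ∪ D₂ → x ∉ T → x ∈ D₂
    in-D₂ x∈ x∉T = [ (λ x∈D₁ → ⊥-elim (x∉T (D₁⊆T x∈D₁))) , (λ x∈D₂ → x∈D₂) ]′ (x∈p∪q⁻ D₁ D₂ x∈)
    covers : ∀ u v → u ∈ S → v ∈ S → u ~ v → u ∈ D₁ ∪ D₂ ⊎ v ∈ D₁ ∪ D₂
    covers u v u∈ v∈ u~v with u ∈? T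
    ... | yes u∈T = Sum.map (x∈p∪q⁺ ∘ inj₁) (x∈p∪q⁺ ∘ inj₁)
                      (covers₁ u v u∈T (T-closed u∈T v∈ u~v) u~v)
    ... | no  u∉T = Sum.map (x∈p∪q⁺ ∘ inj₂) (x∈p∪q⁺ ∘ inj₂)
                      (covers₂ u v u∈S─T (closed-complement T-closed u∈S─T v∈ u~v) u~v)
      where u∈S─T = x∈p∧x∉q⇒x∈p─q u∈ u∉T
    joined : ∀ u v → u ∈ D₁ ∪ D₂ → v ∈ D₁ ∪ D₂ → Walk G S u v → Walk G (D₁ ∪ D₂) u v
    joined u v u∈ v∈ p with u ∈? T
    ... | yes u∈T = walk-mono (p⊆p∪q D₂)
                      (joined₁ u v (in-D₁ u∈ u∈T) (in-D₁ v∈ (walk-last p′)) p′)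
      where p′ = walk-closed T-closed u∈T p
    ... | no  u∉T = walk-mono (q⊆p∪q D₁ D₂)
                      (joined₂ u v (in-D₂ u∈ u∉T) (in-D₂ v∈ (x∈p─q⇒x∉q (walk-last p′))) p′)
      where p′ = walk-closed (closed-complement T-closed) (x∈p∧x∉q⇒x∈p─q (D⊆S u∈) u∉T) p

  module Component (S : Subset (n G)) (v : V) where

    K : Subset (n G)
    K = reach S v

    K-closed : Closed K S
    K-closed u∈ w∈S u~w = reach-complete (walk-snoc (reach-sound {S} {v} u∈) u~w w∈S)

    K⊆S : K ⊆ S
    K⊆S = walk-last ∘ reach-sound {S} {v}

    v∈K : v ∈ S → v ∈ K
    v∈K v∈S = reach-complete (here v∈S)

    K-connected : ∀ {u w} → u ∈ K → w ∈ K → Walk G K u w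
    K-connected u∈ w∈ = walk-trans (walk-sym (from-v u∈)) (from-v w∈)
      where
      from-v : ∀ {x} → x ∈ K → Walk G K v x
      from-v x∈ = walk-closed K-closed (v∈K (walk-head p)) p
        where p = reach-sound {S} {v} x∈

  nonadjacent⇒3≤∣D∣ : ∀ {S D u v} → IsCVC G S D → u ∈ D → v ∈ D → u ≢ v → u ≁ v →
                       Walk G S u v → 3 ≤ ∣ D ∣
  nonadjacent⇒3≤∣D∣ (_ , joined) u∈ v∈ u≢v u≁v p with joined _ _ u∈ v∈ p
  ... | here _        = ⊥-elim (u≢v refl)
  ... | step _ u~w q =
    three-members⇒3≤∣p∣ u∈ (walk-head q) v∈ (~⇒≢ u~w) u≢v (distinguished (adj-flip u~w) (adj-flip u≁v))

-- Every vertex cover of F contains two distinct non-adjacent vertices, so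
-- τ(F) ≥ 2 and, F being connected, τ_c(F) ≥ 3; both bounds are attained.
record PriceObstruction (F : Graph) : Set where
  field
    connected             : ∀ i j → Walk F full i j
    cover                 : Subset (n F)
    cover-size            : ∣ cover ∣ ≤ 2
    cover-isVC            : IsVC F full cover
    connected-cover       : Subset (n F)
    connected-cover-size  : ∣ connected-cover ∣ ≤ 3
    connected-cover-isCVC : IsCVC F full connected-cover
    nonadjacent-pair      : ∀ I → IsVC F full I →
                            ∃₂ λ i j → i ∈ I × j ∈ I × i ≢ j × adj F i j ≡ false

module InducedCopy {F G : Graph} (e : InducedSub F G) where
  open GraphTheory G

  f : Fin (n F) → V
  f = proj₁ e

  f-adj : ∀ i j → adj G (f i) (f j) ≡ adj F i j
  f-adj = proj₂ (proj₂ e)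

  S : Subset (n G)
  S = image f full

  f∈S : ∀ i → f i ∈ S
  f∈S i = ∈-image⁺ f ∈⊤

  image⊆S : ∀ I → image f I ⊆ S
  image⊆S I x∈ with ∈-image⁻ f I x∈
  ... | i , _ , refl = f∈S i

  map-walk : ∀ {I i j} → Walk F I i j → Walk G (image f I) (f i) (f j)
  map-walk (here i∈)       = here (∈-image⁺ f i∈)
  map-walk (step i∈ i~k p) = step (∈-image⁺ f i∈) (trans (f-adj _ _) i~k) (map-walk p)

  image-isVC : ∀ {I} → IsVC F full I → IsVC G S (image f I)
  image-isVC {I} (_ , covers) = image⊆S I , image-covers
    where
    image-covers : ∀ u v → u ∈ S → v ∈ S → u ~ v → u ∈ image f I ⊎ v ∈ image f I
    image-covers u v u∈ v∈ u~v with ∈-image⁻ f full u∈ | ∈-image⁻ f full v∈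
    ... | i , _ , refl | j , _ , refl with covers i j ∈⊤ ∈⊤ (trans (sym (f-adj i j)) u~v)
    ...   | inj₁ i∈ = inj₁ (∈-image⁺ f i∈)
    ...   | inj₂ j∈ = inj₂ (∈-image⁺ f j∈)

  image-isCVC : ∀ {I} → (∀ i j → Walk F full i j) → IsCVC F full I → IsCVC G S (image f I)
  image-isCVC {I} connected (vc , joined) = image-isVC vc , image-joined
    where
    image-joined : ∀ u v → u ∈ image f I → v ∈ image f I → Walk G S u v → Walk G (image f I) u v
    image-joined u v u∈ v∈ _ with ∈-image⁻ f I u∈ | ∈-image⁻ f I v∈
    ... | i , i∈ , refl | j , j∈ , refl = map-walk (joined i j i∈ j∈ (connected i j))

  preimage : Subset (n G) → Subset (n F)
  preimage X = select (λ i → f i ∈? X)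

  preimage-isVC : ∀ {C} → IsVC G S C → IsVC F full (preimage C)
  preimage-isVC {C} (_ , covers) = (λ _ → ∈⊤) , preimage-covers
    where
    preimage-covers : ∀ i j → i ∈ full → j ∈ full → adj F i j ≡ true → i ∈ preimage C ⊎ j ∈ preimage C
    preimage-covers i j _ _ i~j with covers (f i) (f j) (f∈S i) (f∈S j) (trans (f-adj i j) i~j)
    ... | inj₁ fi∈ = inj₁ (∈-select⁺ (λ i → f i ∈? C) fi∈)
    ... | inj₂ fj∈ = inj₂ (∈-select⁺ (λ i → f i ∈? C) fj∈)

  module _ (obstruction : PriceObstruction F) where
    open PriceObstruction obstruction

    nonadjacent-pair-in : ∀ {C} → IsVC G S C →
                          ∃₂ λ i j → f i ∈ C × f j ∈ C × f i ≢ f j × f i ≁ f j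
    nonadjacent-pair-in {C} vc with nonadjacent-pair (preimage C) (preimage-isVC vc)
    ... | i , j , i∈ , j∈ , i≢j , i≁j =
      i , j , ∈-select⁻ (λ i → f i ∈? C) i∈ , ∈-select⁻ (λ i → f i ∈? C) j∈ ,
      i≢j ∘ proj₁ (proj₂ e) , trans (f-adj i j) i≁j

    2≤τ : ∀ {C} → IsVC G S C → 2 ≤ ∣ C ∣
    2≤τ vc with nonadjacent-pair-in vc
    ... | _ , _ , fi∈ , fj∈ , fi≢fj , _ = two-members⇒2≤∣p∣ fi∈ fj∈ fi≢fj

    3≤τc : ∀ {D} → IsCVC G S D → 3 ≤ ∣ D ∣
    3≤τc cvc with nonadjacent-pair-in (proj₁ cvc)
    ... | i , j , fi∈ , fj∈ , fi≢fj , fi≁fj =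
      nonadjacent⇒3≤∣D∣ cvc fi∈ fj∈ fi≢fj fi≁fj (map-walk (connected i j))

    ¬price-bound : ¬ PriceBound G
    ¬price-bound bound = 1+n≰n (begin
      9                  ≤⟨ *-monoʳ-≤ 3 (3≤τc D-isCVC) ⟩
      3 * ∣ D ∣          ≤⟨ bound S C D (C-isVC , C-minimum) (D-isCVC , D-minimum) ⟩
      4 * ∣ C ∣          ≤⟨ *-monoʳ-≤ 4 C-size ⟩
      8                  ∎)
      where
      open ≤-Reasoning
      C = image f cover
      D = image f connected-cover
      C-isVC = image-isVC cover-isVC
      D-isCVC = image-isCVC connected connected-cover-isCVC
      C-size : ∣ C ∣ ≤ 2
      C-size = ≤-trans (∣image∣≤∣p∣ f cover) cover-size
      C-minimum : ∀ C′ → IsVC G S C′ → ∣ C ∣ ≤ ∣ C′ ∣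
      C-minimum C′ vc = ≤-trans C-size (2≤τ vc)
      D-minimum : ∀ D′ → IsCVC G S D′ → ∣ D ∣ ≤ ∣ D′ ∣
      D-minimum D′ cvc = ≤-trans (≤-trans (∣image∣≤∣p∣ f connected-cover) connected-cover-size) (3≤τc cvc)

price-bound⇒¬induced : ∀ {F} → PriceObstruction F → ∀ G → PriceBound G → ¬ InducedSub F G
price-bound⇒¬induced obstruction G bound e = InducedCopy.¬price-bound e obstruction bound

module Decisions (F : Graph) where
  open GraphTheory F

  connected? : Dec (∀ i j → Walk F full i j)
  connected? = all? λ i → all? λ j → walk? full i j

  covers-have-nonadjacent-pairs? :
    Dec (∀ I → IsVC F full I → ∃₂ λ i j → i ∈ I × j ∈ I × i ≢ j × adj F i j ≡ false)
  covers-have-nonadjacent-pairs? = ∀-subset? λ I → isVC? full I →-dec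
    any? λ i → any? λ j → (i ∈? I) ×-dec (j ∈? I) ×-dec ¬? (i Fin.≟ j) ×-dec (adj F i j Boolₚ.≟ false)

P5-obstruction : PriceObstruction (P 5)
P5-obstruction = record
  { connected             = toWitness {a? = connected?} _
  ; cover                 = outside ∷ inside ∷ outside ∷ inside ∷ outside ∷ []
  ; cover-size            = ≤-refl
  ; cover-isVC            = toWitness {a? = isVC? full _} _
  ; connected-cover       = outside ∷ inside ∷ inside ∷ inside ∷ outside ∷ []
  ; connected-cover-size  = ≤-refl
  ; connected-cover-isCVC = toWitness {a? = isCVC? full _} _
  ; nonadjacent-pair      = toWitness {a? = covers-have-nonadjacent-pairs?} _
  }
  where open GraphTheory (P 5); open Decisions (P 5)

C4-obstruction : PriceObstruction C4
C4-obstruction = record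
  { connected             = toWitness {a? = connected?} _
  ; cover                 = inside ∷ outside ∷ inside ∷ outside ∷ []
  ; cover-size            = ≤-refl
  ; cover-isVC            = toWitness {a? = isVC? full _} _
  ; connected-cover       = inside ∷ inside ∷ inside ∷ outside ∷ []
  ; connected-cover-size  = ≤-refl
  ; connected-cover-isCVC = toWitness {a? = isCVC? full _} _
  ; nonadjacent-pair      = toWitness {a? = covers-have-nonadjacent-pairs?} _
  }
  where open GraphTheory C4; open Decisions C4

module P5-free (G : Graph) (noP5 : ¬ InducedSub (P 5) G) where
  open GraphTheory G

  -- No walk of G[Z] leads from a neighbour of y to a neighbour of x: at the last
  -- neighbour w₀ of y reached so far, either w₀ ~ x and b y w₀ x a is an induced
  -- P5, or the next one or two steps of the walk give one starting with b y w₀.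
  module _ {Z : Subset (n G)} {x y a b : V}
           (b~y : b ~ y) (b≁x : b ≁ x) (b≁a : b ≁ a) (b≁Z : ∀ {w} → w ∈ Z → b ≁ w)
           (x~a : x ~ a) (y≁a : y ≁ a) (Z≁a : ∀ {w} → w ∈ Z → w ≁ a) (y≁x : y ≁ x) where

    no-walk : ∀ {w₀ wₘ} → y ~ w₀ → Walk G Z w₀ wₘ → x ~ wₘ → ⊥
    no-walk-beyond : ∀ {w₀ wₘ} → y ~ w₀ → x ≁ w₀ → Walk G Z w₀ wₘ → x ~ wₘ → ⊥
    no-walk-detour : ∀ {w₀ w₁ wₘ} → w₀ ∈ Z → y ~ w₀ → x ≁ w₀ → w₀ ~ w₁ → y ≁ w₁ → x ≁ w₁ →
                     Walk G Z w₁ wₘ → x ~ wₘ → ⊥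

    no-walk {w₀} y~w₀ p x~wₘ with adj G x w₀ in x-w₀
    ... | true  = noP5 (induced-P5 b~y y~w₀ (adj-flip x-w₀) x~a
                          (b≁Z (walk-head p)) b≁x b≁a y≁x y≁a (Z≁a (walk-head p)))
    ... | false = no-walk-beyond y~w₀ x-w₀ p x~wₘ

    no-walk-beyond y~w₀ x≁w₀ (here _) x~w₀ with () ← trans (sym x~w₀) x≁w₀
    no-walk-beyond y~w₀ x≁w₀ (step {w = w₁} w₀∈ w₀~w₁ p) x~wₘ
      with adj G y w₁ in y-w₁ | adj G x w₁ in x-w₁
    ... | true  | _     = no-walk y-w₁ p x~wₘ
    ... | false | true  = noP5 (induced-P5 b~y y~w₀ w₀~w₁ (adj-flip x-w₁)
                                 (b≁Z w₀∈) (b≁Z (walk-head p)) b≁x y-w₁ y≁x (adj-flip x≁w₀))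
    ... | false | false = no-walk-detour w₀∈ y~w₀ x≁w₀ w₀~w₁ y-w₁ x-w₁ p x~wₘ

    no-walk-detour _ _ _ _ _ x≁w₁ (here _) x~w₁ with () ← trans (sym x~w₁) x≁w₁
    no-walk-detour {w₀} w₀∈ y~w₀ x≁w₀ w₀~w₁ y≁w₁ x≁w₁ (step {w = w₂} w₁∈ w₁~w₂ p) x~wₘ
      with adj G y w₂ in y-w₂ | adj G w₀ w₂ in w₀-w₂
    ... | true  | _     = no-walk y-w₂ p x~wₘ
    ... | false | false = noP5 (induced-P5 b~y y~w₀ w₀~w₁ w₁~w₂
                                 (b≁Z w₀∈) (b≁Z w₁∈) (b≁Z (walk-head p)) y≁w₁ y-w₂ w₀-w₂)
    ... | false | true with adj G x w₂ in x-w₂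
    ...   | true  = noP5 (induced-P5 b~y y~w₀ w₀-w₂ (adj-flip x-w₂)
                            (b≁Z w₀∈) (b≁Z (walk-head p)) b≁x y-w₂ y≁x (adj-flip x≁w₀))
    ...   | false = no-walk-detour w₀∈ y~w₀ x≁w₀ w₀-w₂ y-w₂ x-w₂ p x~wₘ

module P5-C4-free (G : Graph) (noP5 : ¬ InducedSub (P 5) G) (noC4 : ¬ InducedSub C4 G) where
  open GraphTheory G
  open P5-free G noP5

  module ConnectedCover {K C : Subset (n G)}
                        (K-connected : ∀ {u v} → u ∈ K → v ∈ K → Walk G K u v)
                        (C-isVC : IsVC G K C) where

    C⊆K : C ⊆ K
    C⊆K = proj₁ C-isVC

    other-end : ∀ {u v} → u ∈ K → u ∉ C → v ∈ K → u ~ v → v ∈ C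
    other-end u∈ u∉C v∈ u~v = [ ⊥-elim ∘ u∉C , (λ v∈C → v∈C) ]′ (proj₂ C-isVC _ _ u∈ v∈ u~v)

    independent : ∀ {x y} → x ∈ K → x ∉ C → y ∈ K → y ∉ C → x ≁ y
    independent x∈ x∉C y∈ y∉C = ¬~⇒≁ (y∉C ∘ other-end x∈ x∉C y∈)

    Linked : V → V → Set
    Linked x c = ∃ λ a → a ∈ C × x ~ a × Walk G C a c

    linked? : ∀ x → Decidable (Linked x)
    linked? x c = any? λ a → (a ∈? C) ×-dec adj? x a ×-dec walk? C a c

    opaque
      R : V → Subset (n G)
      R x = select (linked? x)

      R-intro : ∀ {x a c} → a ∈ C → x ~ a → Walk G C a c → c ∈ R x
      R-intro a∈ x~a p = ∈-select⁺ (linked? _) (_ , a∈ , x~a , p)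

      R-elim : ∀ {x c} → c ∈ R x → Linked x c
      R-elim = ∈-select⁻ (linked? _)

    R⊆C : ∀ {x} → R x ⊆ C
    R⊆C c∈ with R-elim c∈
    ... | _ , _ , _ , p = walk-last p

    R-extend : ∀ {x c d} → c ∈ R x → Walk G C c d → d ∈ R x
    R-extend c∈ q with R-elim c∈
    ... | _ , a∈ , x~a , p = R-intro a∈ x~a (walk-trans p q)

    R-neighbour : ∀ {x c} → c ∈ C → x ~ c → c ∈ R x
    R-neighbour c∈ x~c = R-intro c∈ x~c (here c∈)

    R-edge : ∀ {x c d} → c ∈ R x → d ∈ C → c ~ d → d ∈ R x
    R-edge c∈ d∈ c~d = R-extend c∈ (step (R⊆C c∈) c~d (here d∈))

    R≁outside : ∀ {x c d} → c ∈ R x → d ∈ C → d ∉ R x → c ≁ d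
    R≁outside c∈ d∈ d∉ = ¬~⇒≁ (d∉ ∘ R-edge c∈ d∈)

    ≁outside : ∀ {x d} → d ∈ C → d ∉ R x → x ≁ d
    ≁outside d∈ d∉ = ¬~⇒≁ (d∉ ∘ R-neighbour d∈)

    -- Each neighbour a₂ of x in C lies in R y: otherwise the walk in G[C] from a
    -- back to a neighbour of x stays inside R x ∩ R y, which no-walk forbids
    -- (b is cut off from R x, and a₂ from R y).
    R-absorbed : ∀ {x y a b} → x ∈ K → x ∉ C → y ∈ K → y ∉ C →
                 a ∈ R x → y ~ a → b ∈ C → b ∉ R x → y ~ b → R x ⊆ R y
    R-absorbed {x} {y} {b = b} x∈K x∉C y∈K y∉C a∈Rx y~a b∈C b∉Rx y~b c∈Rx with R-elim c∈Rx
    ... | a₂ , a₂∈C , x~a₂ , p = R-extend (in-Ry a₂∈C x~a₂) p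
      where
      Z = R x ∩ R y
      Z-closed : Closed Z C
      Z-closed w∈ d∈ w~d with x∈p∩q⁻ (R x) (R y) w∈
      ... | w∈Rx , w∈Ry = x∈p∩q⁺ (R-edge w∈Rx d∈ w~d , R-edge w∈Ry d∈ w~d)
      b≁Z : ∀ {w} → w ∈ Z → b ≁ w
      b≁Z w∈ = adj-flip (R≁outside (proj₁ (x∈p∩q⁻ (R x) (R y) w∈)) b∈C b∉Rx)
      in-Ry : ∀ {a₂} → a₂ ∈ C → x ~ a₂ → a₂ ∈ R y
      in-Ry {a₂} a₂∈C x~a₂ with a₂ ∈? R y | R-elim a∈Rx
      ... | yes a₂∈Ry | _ = a₂∈Ry
      ... | no  a₂∉Ry | _ , _ , x~a₁ , q = ⊥-elim (no-walk
            (adj-flip y~b) (adj-flip (≁outside b∈C b∉Rx))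
            (adj-flip (R≁outside (R-neighbour a₂∈C x~a₂) b∈C b∉Rx)) b≁Z
            x~a₂ (≁outside a₂∈C a₂∉Ry) (λ w∈ → R≁outside (proj₂ (x∈p∩q⁻ (R x) (R y) w∈)) a₂∈C a₂∉Ry)
            (independent y∈K y∉C x∈K x∉C)
            y~a (walk-closed Z-closed a∈Z (walk-sym q)) x~a₁)
        where a∈Z = x∈p∩q⁺ (a∈Rx , R-neighbour (R⊆C a∈Rx) y~a)

    Near : V → V → Set
    Near x w = w ≡ x ⊎ w ∈ R x ⊎ (w ∉ C × ∃ λ a → a ∈ R x × w ~ a)

    near? : ∀ x → Decidable (Near x)
    near? x w =
      (w Fin.≟ x) ⊎-dec (w ∈? R x) ⊎-dec (¬? (w ∈? C) ×-dec any? λ a → (a ∈? R x) ×-dec adj? w a)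

    -- A walk from x to a vertex of C outside R x leaves the vertices near x
    -- through a vertex y ∉ C that links R x to the rest of C.
    R-grows : ∀ {x c} → x ∈ K → x ∉ C → c ∈ C → c ∉ R x → ∃ λ y → y ∈ K × y ∉ C × R x ⊂ R y
    R-grows {x} {c} x∈K x∉C c∈C c∉Rx
      with walk-crossing (near? x) (K-connected x∈K (C⊆K c∈C)) (inj₁ refl) c-far
      where
      c-far : ¬ Near x c
      c-far (inj₁ refl)              = x∉C c∈C
      c-far (inj₂ (inj₁ c∈Rx))       = c∉Rx c∈Rx
      c-far (inj₂ (inj₂ (c∉C , _))) = c∉C c∈C
    ... | _ , v , _ , v∈K , inj₁ refl , v-far , x~v =
      ⊥-elim (v-far (inj₂ (inj₁ (R-neighbour (other-end x∈K x∉C v∈K x~v) x~v))))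
    ... | u , v , _ , _ , inj₂ (inj₁ u∈Rx) , v-far , u~v with v ∈? C
    ...   | yes v∈C = ⊥-elim (v-far (inj₂ (inj₁ (R-edge u∈Rx v∈C u~v))))
    ...   | no  v∉C = ⊥-elim (v-far (inj₂ (inj₂ (v∉C , u , u∈Rx , adj-flip u~v))))
    R-grows x∈K x∉C _ _ | y , b , y∈K , b∈K , inj₂ (inj₂ (y∉C , a , a∈Rx , y~a)) , b-far , y~b =
      y , y∈K , y∉C , R-absorbed x∈K x∉C y∈K y∉C a∈Rx y~a b∈C b∉Rx y~b , b , R-neighbour b∈C y~b , b∉Rx
      where
      b∈C = other-end y∈K y∉C b∈K y~b
      b∉Rx = b-far ∘ inj₂ ∘ inj₁

    dominating-vertex : ∀ {x} → Acc _⊃_ (R x) → x ∈ K → x ∉ C → ∃ λ z → z ∈ K × z ∉ C × C ⊆ R z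
    dominating-vertex {x} (acc rec) x∈K x∉C with any? (λ c → (c ∈? C) ×-dec ¬? (c ∈? R x))
    ... | no  none = x , x∈K , x∉C , λ {c} c∈C → decidable-stable (c ∈? R x) (λ c∉ → none (c , c∈C , c∉))
    ... | yes (c , c∈C , c∉Rx) with R-grows x∈K x∉C c∈C c∉Rx
    ...   | y , y∈K , y∉C , Rx⊂Ry = dominating-vertex (rec Rx⊂Ry) y∈K y∉C

    dominated-isCVC : ∀ {x} → x ∈ K → C ⊆ R x → IsCVC G K (C ∪ ⁅ x ⁆)
    dominated-isCVC {x} x∈K C⊆Rx =
      (D⊆K , covers) , λ _ _ u∈ v∈ _ → walk-trans (walk-sym (from-x u∈)) (from-x v∈)
      where
      D⊆K : C ∪ ⁅ x ⁆ ⊆ K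
      D⊆K u∈ with x∈p∪q⁻ C ⁅ x ⁆ u∈
      ... | inj₁ u∈C = C⊆K u∈C
      ... | inj₂ u∈x rewrite x∈⁅y⁆⇒x≡y x u∈x = x∈K
      covers : ∀ u v → u ∈ K → v ∈ K → u ~ v → u ∈ C ∪ ⁅ x ⁆ ⊎ v ∈ C ∪ ⁅ x ⁆
      covers u v u∈ v∈ u~v = Sum.map (p⊆p∪q _) (p⊆p∪q _) (proj₂ C-isVC u v u∈ v∈ u~v)
      from-x : ∀ {u} → u ∈ C ∪ ⁅ x ⁆ → Walk G (C ∪ ⁅ x ⁆) x u
      from-x u∈ with x∈p∪q⁻ C ⁅ x ⁆ u∈
      ... | inj₂ u∈x rewrite x∈⁅y⁆⇒x≡y x u∈x = here (q⊆p∪q C ⁅ x ⁆ (x∈⁅x⁆ x))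
      ... | inj₁ u∈C with R-elim (C⊆Rx u∈C)
      ...   | _ , _ , x~a , p = step (q⊆p∪q C ⁅ x ⁆ (x∈⁅x⁆ x)) x~a (walk-mono (p⊆p∪q _) p)

    private-neighbour? : ∀ u v → Decidable (λ y → y ∈ K × u ~ y × ¬ v ~ y)
    private-neighbour? u v y = (y ∈? K) ×-dec adj? u y ×-dec ¬? (adj? v y)

    module _ {u v : V} (C-pair : ∀ {w} → w ∈ C → w ≡ u ⊎ w ≡ v) (u≁v : u ≁ v) where

      C-independent : ∀ {c d} → c ∈ C → d ∈ C → c ≁ d
      C-independent c∈ d∈ with C-pair c∈ | C-pair d∈
      ... | inj₁ refl | inj₁ refl = irrefl G _
      ... | inj₁ refl | inj₂ refl = u≁v
      ... | inj₂ refl | inj₁ refl = adj-flip u≁v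
      ... | inj₂ refl | inj₂ refl = irrefl G _

      neighbour∉C : ∀ {c y} → c ∈ C → c ~ y → y ∉ C
      neighbour∉C c∈ c~y y∈ with () ← trans (sym c~y) (C-independent c∈ y∈)

      -- If every neighbour of u is one of v, then x is the only neighbour of u
      -- (another one, y, would close the induced C4 u x v y), so {x, v} works.
      pendant-cover : ∀ {x} → u ∈ C → v ∈ C → u ≢ v → x ∈ K → x ∉ C → x ~ u → x ~ v →
                      (∀ {y} → y ∈ K → u ~ y → v ~ y) → ∃ λ D → IsCVC G K D × ∣ D ∣ ≤ 2
      pendant-cover {x} u∈C v∈C u≢v x∈K x∉C x~u x~v N[u]⊆N[v] =
        D , ((D⊆K , covers) , joined) , ∣⁅x⁆∪⁅y⁆∣≤2 x v
        where
        D = ⁅ x ⁆ ∪ ⁅ v ⁆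
        x∈D : x ∈ D
        x∈D = p⊆p∪q ⁅ v ⁆ (x∈⁅x⁆ x)
        v∈D : v ∈ D
        v∈D = q⊆p∪q ⁅ x ⁆ ⁅ v ⁆ (x∈⁅x⁆ v)
        D⊆K : D ⊆ K
        D⊆K w∈ = [ (λ { refl → x∈K }) , (λ { refl → C⊆K v∈C }) ]′ (∈⁅x⁆∪⁅y⁆⁻ w∈)
        only-x : ∀ {y} → y ∈ K → u ~ y → y ∈ D
        only-x {y} y∈K u~y with y Fin.≟ x
        ... | yes refl = x∈D
        ... | no  y≢x  = ⊥-elim (noC4 (induced-C4 (adj-flip x~u) x~v (N[u]⊆N[v] y∈K u~y) (adj-flip u~y)
                           u≁v (independent x∈K x∉C y∈K (neighbour∉C u∈C u~y)) u≢v (≢-sym y≢x)))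
        covers : ∀ a b → a ∈ K → b ∈ K → a ~ b → a ∈ D ⊎ b ∈ D
        covers a b a∈ b∈ a~b with proj₂ C-isVC a b a∈ b∈ a~b
        ... | inj₁ a∈C = [ (λ { refl → inj₂ (only-x b∈ a~b) }) , (λ { refl → inj₁ v∈D }) ]′ (C-pair a∈C)
        ... | inj₂ b∈C = [ (λ { refl → inj₁ (only-x a∈ (adj-flip a~b)) }) , (λ { refl → inj₂ v∈D }) ]′ (C-pair b∈C)
        to-x : ∀ {w} → w ∈ D → Walk G D w x
        to-x w∈ = [ (λ { refl → here x∈D }) , (λ { refl → step v∈D (adj-flip x~v) (here x∈D) }) ]′ (∈⁅x⁆∪⁅y⁆⁻ w∈)
        joined : ∀ a b → a ∈ D → b ∈ D → Walk G K a b → Walk G D a b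
        joined _ _ a∈ b∈ _ = walk-trans (to-x a∈) (walk-sym (to-x b∈))

    two-vertex-cover : ∀ {u v x} → (∀ {w} → w ∈ C → w ≡ u ⊎ w ≡ v) → u ≁ v →
                       u ∈ C → v ∈ C → u ≢ v → x ∈ K → x ∉ C → x ~ u → x ~ v →
                       ∃ λ D → IsCVC G K D × ∣ D ∣ ≤ 2
    two-vertex-cover {u} {v} C-pair u≁v u∈C v∈C u≢v x∈K x∉C x~u x~v
      with any? (private-neighbour? u v) | any? (private-neighbour? v u)
    ... | no none | _ = pendant-cover C-pair u≁v u∈C v∈C u≢v x∈K x∉C x~u x~v
            (λ {y} y∈ u~y → decidable-stable (adj? v y) (λ ¬v~y → none (y , y∈ , u~y , ¬v~y)))
    ... | _ | no none = pendant-cover (Sum.swap ∘ C-pair) (adj-flip u≁v) v∈C u∈C (≢-sym u≢v) x∈K x∉C x~v x~u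
            (λ {y} y∈ v~y → decidable-stable (adj? u y) (λ ¬u~y → none (y , y∈ , v~y , ¬u~y)))
    ... | yes (y₁ , y₁∈K , u~y₁ , ¬v~y₁) | yes (y₂ , y₂∈K , v~y₂ , ¬u~y₂) =
      ⊥-elim (noP5 (induced-P5 (adj-flip u~y₁) (adj-flip x~u) x~v v~y₂
        (independent y₁∈K y₁∉C x∈K x∉C) (adj-flip (¬~⇒≁ ¬v~y₁)) (independent y₁∈K y₁∉C y₂∈K y₂∉C)
        u≁v (¬~⇒≁ ¬u~y₂) (independent x∈K x∉C y₂∈K y₂∉C)))
      where
      y₁∉C = neighbour∉C C-pair u≁v u∈C u~y₁
      y₂∉C = neighbour∉C C-pair u≁v v∈C v~y₂

    module _ {u v : V} (u∈C : u ∈ C) (v∈C : v ∈ C) (¬u⇝v : ¬ Walk G C u v) where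

      outside-vertex : ∃ λ x → x ∈ K × x ∉ C
      outside-vertex with any? (λ x → (x ∈? K) ×-dec ¬? (x ∈? C))
      ... | yes found = found
      ... | no  none  = ⊥-elim (¬u⇝v (walk-mono K⊆C (K-connected (C⊆K u∈C) (C⊆K v∈C))))
        where
        K⊆C : K ⊆ C
        K⊆C {x} x∈K = decidable-stable (x ∈? C) (λ x∉C → none (x , x∈K , x∉C))

      u≢v : u ≢ v
      u≢v refl = ¬u⇝v (here u∈C)

      u≁v : u ≁ v
      u≁v = ¬~⇒≁ λ u~v → ¬u⇝v (step u∈C u~v (here v∈C))

      small-cover-bound : ∀ {x} → ¬ 3 ≤ ∣ C ∣ → x ∈ K → x ∉ C → C ⊆ R x →
                          ∃ λ D → IsCVC G K D × 3 * ∣ D ∣ ≤ 4 * ∣ C ∣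
      small-cover-bound {x} ∣C∣<3 x∈K x∉C C⊆Rx
        with two-vertex-cover C-pair u≁v u∈C v∈C u≢v x∈K x∉C (adjacent-to u∈C) (adjacent-to v∈C)
        where
        C-pair : ∀ {w} → w ∈ C → w ≡ u ⊎ w ≡ v
        C-pair {w} w∈C with w Fin.≟ u | w Fin.≟ v
        ... | yes w≡u | _       = inj₁ w≡u
        ... | no  _   | yes w≡v = inj₂ w≡v
        ... | no  w≢u | no  w≢v = ⊥-elim (∣C∣<3 (three-members⇒3≤∣p∣ u∈C v∈C w∈C u≢v (≢-sym w≢u) (≢-sym w≢v)))
        -- x reaches u and v inside C ∪ {x} only directly, as G[C] does not join them.
        adjacent-to : ∀ {c} → c ∈ C → x ~ c
        adjacent-to {c} c∈C with R-elim (C⊆Rx c∈C)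
        ... | a , a∈C , x~a , p with C-pair a∈C | C-pair c∈C
        ...   | inj₁ refl | inj₁ refl = x~a
        ...   | inj₂ refl | inj₂ refl = x~a
        ...   | inj₁ refl | inj₂ refl = ⊥-elim (¬u⇝v p)
        ...   | inj₂ refl | inj₁ refl = ⊥-elim (¬u⇝v (walk-sym p))
      ... | D , D-isCVC , ∣D∣≤2 = D , D-isCVC , 3*d≤4*c ∣D∣≤2 (two-members⇒2≤∣p∣ u∈C v∈C u≢v)

      disconnected-cover-bound : ∃ λ D → IsCVC G K D × 3 * ∣ D ∣ ≤ 4 * ∣ C ∣
      disconnected-cover-bound with outside-vertex
      ... | x₀ , x₀∈K , x₀∉C with dominating-vertex (⊃-wellFounded _) x₀∈K x₀∉C
      ...   | x , x∈K , x∉C , C⊆Rx with 3 ≤? ∣ C ∣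
      ...     | no  ∣C∣<3 = small-cover-bound ∣C∣<3 x∈K x∉C C⊆Rx
      ...     | yes 3≤∣C∣ = C ∪ ⁅ x ⁆ , dominated-isCVC x∈K C⊆Rx ,
                            ≤-trans (*-monoʳ-≤ 3 (∣p∪⁅x⁆∣≤1+∣p∣ C x)) (3*[1+c]≤4*c ∣ C ∣ 3≤∣C∣)

    connected-cover-bound : ∃ λ D → IsCVC G K D × 3 * ∣ D ∣ ≤ 4 * ∣ C ∣
    connected-cover-bound with any? (λ u → any? λ v → (u ∈? C) ×-dec (v ∈? C) ×-dec ¬? (walk? C u v))
    ... | yes (u , v , u∈C , v∈C , ¬u⇝v) = disconnected-cover-bound u∈C v∈C ¬u⇝v
    ... | no  all-joined = C , (C-isVC , joined) , *-monoˡ-≤ ∣ C ∣ (n≤1+n 3)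
      where
      joined : ∀ u v → u ∈ C → v ∈ C → Walk G K u v → Walk G C u v
      joined u v u∈ v∈ _ = decidable-stable (walk? C u v) λ ¬u⇝v → all-joined (u , v , u∈ , v∈ , ¬u⇝v)

  cover-bound : ∀ S → Acc _⊂_ S → ∀ C → IsVC G S C → ∃ λ D → IsCVC G S D × 3 * ∣ D ∣ ≤ 4 * ∣ C ∣
  cover-bound S (acc rec) C C-isVC with any? (_∈? S)
  ... | no  S-empty =
    ∅ , ∅-isCVC (λ v v∈ → S-empty (v , v∈)) , subst (λ k → 3 * k ≤ 4 * ∣ C ∣) (sym (∣⊥∣≡0 (n G))) z≤n
  ... | yes (v , v∈S) = D₁ ∪ D₂ , IsCVC-∪ K⊆S K-closed D₁-isCVC D₂-isCVC , size
    where
    open Component S v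
    open ConnectedCover K-connected (IsVC-∩ K⊆S C-isVC)
      using () renaming (connected-cover-bound to K-bound)
    D₁ = proj₁ K-bound
    D₁-isCVC = proj₁ (proj₂ K-bound)
    rest = cover-bound (S ─ K) (rec (p∩q≢∅⇒p─q⊂p S K (v , x∈p∩q⁺ (v∈S , v∈K v∈S))))
                       (C ─ K) (IsVC-─ C-isVC)
    D₂ = proj₁ rest
    D₂-isCVC = proj₁ (proj₂ rest)
    size : 3 * ∣ D₁ ∪ D₂ ∣ ≤ 4 * ∣ C ∣
    size = begin
      3 * ∣ D₁ ∪ D₂ ∣                ≤⟨ *-monoʳ-≤ 3 (∣p∪q∣≤∣p∣+∣q∣ D₁ D₂) ⟩
      3 * (∣ D₁ ∣ + ∣ D₂ ∣)          ≡⟨ *-distribˡ-+ 3 ∣ D₁ ∣ ∣ D₂ ∣ ⟩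
      3 * ∣ D₁ ∣ + 3 * ∣ D₂ ∣        ≤⟨ +-mono-≤ (proj₂ (proj₂ K-bound)) (proj₂ (proj₂ rest)) ⟩
      4 * ∣ C ∩ K ∣ + 4 * ∣ C ─ K ∣  ≡⟨ sym (*-distribˡ-+ 4 ∣ C ∩ K ∣ ∣ C ─ K ∣) ⟩
      4 * (∣ C ∩ K ∣ + ∣ C ─ K ∣)    ≡⟨ cong (4 *_) (∣p∩q∣+∣p─q∣≡∣p∣ C K) ⟩
      4 * ∣ C ∣                      ∎
      where open ≤-Reasoning

  price-bound : PriceBound G
  price-bound S C D (C-isVC , _) (_ , D-minimum) with cover-bound S (⊂-wellFounded S) C C-isVC
  ... | D′ , D′-isCVC , bound = ≤-trans (*-monoʳ-≤ 3 (D-minimum D′ D′-isCVC)) bound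

theorem3 : (G : Graph) → PriceBound G ⇔ (¬ InducedSub (P 5) G × ¬ InducedSub C4 G)
theorem3 G = mk⇔
  (λ bound → price-bound⇒¬induced P5-obstruction G bound , price-bound⇒¬induced C4-obstruction G bound)
  (λ (noP5 , noC4) → P5-C4-free.price-bound G noP5 noC4)
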